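{- Let $T$ be a tree of order $n\ge 3$ with diameter $d(T)$ and chromatic number $\chi(T)$. Then $$\max\{\chi(T),\lceil\log_2(d(T)+1)\rceil\}\le vcfc(T)\le \log_{3/2} n.$$
   Context: Vertex-colorings are arbitrary, not necessarily proper. A path in a vertex-colored graph is called conflict-free if there is a color used on exactly one of its vertices. A vertex-colored graph is conflict-free vertex-connected if any two vertices of the graph are connected by a conflict-free path. For a connected graph $G$, the conflict-free vertex-connection number $vcfc(G)$ is the smallest number of colors needed in a vertex-coloring of $G$ that makes $G$ conflict-free vertex-connected. -}

module Defs where

open import Data.Nat using (ℕ; zero; suc; _≤_; _+_)
open import Data.Fin using (Fin)
open import Data.Bool using (Bool; true; false)
open import Data.List using (List; []; _∷_; length; filter)
open import Data.List.Relation.Unary.Unique.Propositional using (Unique)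
open import Data.Product using (Σ; ∃; ∃-syntax; _×_; _,_)
open import Relation.Nullary using (¬_)
open import Relation.Binary.PropositionalEquality using (_≡_; _≢_)
open import Data.Fin using (_≟_)

record Graph (n : ℕ) : Set where
  field
    adj     : Fin n → Fin n → Bool
    symm    : ∀ i j → adj i j ≡ adj j i
    irrefl  : ∀ i → adj i i ≡ false

open Graph public

module _ {n : ℕ} (G : Graph n) where

  Adj : Fin n → Fin n → Set
  Adj i j = adj G i j ≡ true

  data IsWalk : Fin n → Fin n → List (Fin n) → Set where
    single : ∀ u → IsWalk u u (u ∷ [])
    step   : ∀ {u w v p} → Adj u w → IsWalk w v p → IsWalk u v (u ∷ p)

  IsPath : Fin n → Fin n → List (Fin n) → Set
  IsPath u v p = IsWalk u v p × Unique p

  Connected : Set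
  Connected = ∀ u v → ∃[ p ] IsPath u v p

  HasCycle : Set
  HasCycle = ∃[ u ] ∃[ w ] ∃[ p ] (IsPath u w p × 3 ≤ length p × Adj w u)

  IsTree : Set
  IsTree = Connected × ¬ HasCycle

  -- distance: d is the number of edges of a shortest u-v path
  IsDistance : Fin n → Fin n → ℕ → Set
  IsDistance u v d =
    (∃[ p ] (IsPath u v p × length p ≡ suc d)) ×
    (∀ p → IsPath u v p → suc d ≤ length p)

  IsDiameter : ℕ → Set
  IsDiameter D =
    (∃[ u ] ∃[ v ] IsDistance u v D) ×
    (∀ u v d → IsDistance u v d → d ≤ D)

  ProperColoring : {k : ℕ} → (Fin n → Fin k) → Set
  ProperColoring c = ∀ i j → Adj i j → c i ≢ c j

  ProperColorable : ℕ → Set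
  ProperColorable k = Σ (Fin n → Fin k) ProperColoring

  IsChromaticNumber : ℕ → Set
  IsChromaticNumber k = ProperColorable k × (∀ j → ProperColorable j → k ≤ j)

  countColour : {k : ℕ} → (Fin n → Fin k) → Fin k → List (Fin n) → ℕ
  countColour c col p = length (filter (λ x → c x ≟ col) p)

  ConflictFree : {k : ℕ} → (Fin n → Fin k) → List (Fin n) → Set
  ConflictFree c p = ∃[ col ] countColour c col p ≡ 1

  CFVertexConnected : {k : ℕ} → (Fin n → Fin k) → Set
  CFVertexConnected c = ∀ u v → ∃[ p ] (IsPath u v p × ConflictFree c p)

  CFColorable : ℕ → Set
  CFColorable k = Σ (Fin n → Fin k) CFVertexConnected

  IsVcfc : ℕ → Set
  IsVcfc k = CFColorable k × (∀ j → CFColorable j → k ≤ j)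

-- Between adjacent vertices of a tree the only path is the edge,
-- so a conflict-free colouring is proper.  Every segment of a longest path is the
-- unique path between its ends, hence conflict-free; deleting the vertex whose
-- colour occurs once leaves two such segments avoiding that colour, so by
-- induction on the number of colours the path has fewer than 2^k vertices.
--
-- A component with fewer than 2^(m+1) vertices has a centroid, a
-- vertex whose removal leaves components of fewer than 2^m vertices.  Giving one
-- centroid per component the top colour and recursing on the rest yields m+1
-- colours such that every path has a unique vertex of maximum colour, whose colour
-- is then conflict-free.  Choosing 2^m ≤ n < 2^(m+1) gives vcfc(T) ≤ m+1, and
-- (3/2)^(m+1) ≤ n holds because n ≥ 3.

module Submission where

open import Defs
open import Data.Nat using (ℕ; zero; suc; _≤_; _<_; _≤′_; _+_; _*_; _^_; z≤n; s≤s; _<?_; _≤?_; NonZero; ≤′-reflexive; ≤′-step)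
open import Data.Nat.Properties hiding (_≟_)
open import Data.Nat.Induction using (<-wellFounded)
open import Data.Nat.Solver using (module +-*-Solver)
open import Data.Fin using (Fin; zero; suc; toℕ; fromℕ<; _≟_)
import Data.Fin.Properties as Fin
open import Data.List using (List; []; _∷_; _++_; length; filter)
open import Data.List.Properties using (++-assoc; ++-identityʳ; ++-conicalˡ; length-++; filter-accept; filter-reject)
open import Data.List.Membership.Propositional using (_∈_; _∉_; find)
open import Data.List.Membership.Propositional.Properties using (∈-++⁻)
open import Data.List.Relation.Binary.Subset.Propositional using () renaming (_⊆_ to _⊆ₗ_)
open import Data.List.Relation.Binary.Subset.Propositional.Properties using (All-resp-⊇)
open import Data.List.Relation.Unary.Any using (here; there; any?)
open import Data.List.Relation.Unary.All as All using (All; []; _∷_)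
open import Data.List.Relation.Unary.All.Properties using (++⁻; All¬⇒¬Any; ¬Any⇒All¬)
open import Data.List.Relation.Unary.AllPairs using ([]; _∷_)
open import Data.List.Relation.Unary.Unique.Propositional using (Unique)
open import Data.Product using (∃; ∃₂; _×_; _,_; proj₁; proj₂)
open import Data.Sum using (_⊎_; inj₁; inj₂; [_,_])
open import Data.Empty using (⊥; ⊥-elim)
open import Data.Unit using (tt)
open import Function using (_∘_; id)
open import Induction.WellFounded using (Acc; acc)
open import Level using (0ℓ)
open import Relation.Nullary using (Dec; yes; no; ¬_; contradiction)
open import Relation.Nullary.Decidable using (_×-dec_; _→-dec_; ¬?; from-yes)
open import Relation.Unary using (Pred; Decidable; Empty; _⊆_) renaming (_⊥_ to _Disjoint_)
open import Relation.Binary.Definitions using (tri<; tri≈; tri>)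
open import Relation.Binary.PropositionalEquality
  using (_≡_; _≢_; refl; sym; trans; cong; subst; subst₂; module ≡-Reasoning)

open +-*-Solver

size : ∀ {m} {P : Pred (Fin m) 0ℓ} → Decidable P → ℕ
size {zero}  P? = 0
size {suc m} P? with P? zero
... | yes _ = suc (size (P? ∘ suc))
... | no  _ = size (P? ∘ suc)

size≤ : ∀ {m} {P : Pred (Fin m) 0ℓ} (P? : Decidable P) → size P? ≤ m
size≤ {zero}  P? = z≤n
size≤ {suc m} P? with P? zero
... | yes _ = s≤s (size≤ (P? ∘ suc))
... | no  _ = m≤n⇒m≤1+n (size≤ (P? ∘ suc))

size-mono : ∀ {m} {P Q : Pred (Fin m) 0ℓ} (P? : Decidable P) (Q? : Decidable Q) →
            P ⊆ Q → size P? ≤ size Q?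
size-mono {zero}  P? Q? P⊆Q = z≤n
size-mono {suc m} P? Q? P⊆Q with P? zero | Q? zero
... | yes _ | yes _ = s≤s (size-mono (P? ∘ suc) (Q? ∘ suc) P⊆Q)
... | yes p | no ¬q = contradiction (P⊆Q p) ¬q
... | no  _ | yes _ = m≤n⇒m≤1+n (size-mono (P? ∘ suc) (Q? ∘ suc) P⊆Q)
... | no  _ | no  _ = size-mono (P? ∘ suc) (Q? ∘ suc) P⊆Q

size-mono-< : ∀ {m} {P Q : Pred (Fin m) 0ℓ} (P? : Decidable P) (Q? : Decidable Q) →
              P ⊆ Q → ∀ {i} → Q i → ¬ P i → size P? < size Q?
size-mono-< {suc m} P? Q? P⊆Q {i} qi ¬pi with P? zero | Q? zero | i
... | yes p | no ¬q | _     = contradiction (P⊆Q p) ¬q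
... | yes p | yes _ | zero  = contradiction p ¬pi
... | yes _ | yes _ | suc i = s≤s (size-mono-< (P? ∘ suc) (Q? ∘ suc) P⊆Q qi ¬pi)
... | no  _ | yes _ | _     = s≤s (size-mono (P? ∘ suc) (Q? ∘ suc) P⊆Q)
... | no  _ | no ¬q | zero  = contradiction qi ¬q
... | no  _ | no  _ | suc i = size-mono-< (P? ∘ suc) (Q? ∘ suc) P⊆Q qi ¬pi

size-pos : ∀ {m} {P : Pred (Fin m) 0ℓ} (P? : Decidable P) → ∀ {i} → P i → 0 < size P?
size-pos {suc m} P? {i} pi with P? zero | i
... | yes _ | _     = s≤s z≤n
... | no ¬p | zero  = contradiction pi ¬p
... | no  _ | suc i = size-pos (P? ∘ suc) pi

size-disjoint : ∀ {m} {P Q R : Pred (Fin m) 0ℓ}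
                (P? : Decidable P) (Q? : Decidable Q) (R? : Decidable R) →
                P ⊆ R → Q ⊆ R → P Disjoint Q → size P? + size Q? ≤ size R?
size-disjoint {zero}  P? Q? R? P⊆R Q⊆R P⊥Q = z≤n
size-disjoint {suc m} P? Q? R? P⊆R Q⊆R P⊥Q with P? zero | Q? zero | R? zero
... | yes p | yes q | _     = contradiction (p , q) P⊥Q
... | yes p | no  _ | no ¬r = contradiction (P⊆R p) ¬r
... | no  _ | yes q | no ¬r = contradiction (Q⊆R q) ¬r
... | yes _ | no  _ | yes _ = s≤s (size-disjoint (P? ∘ suc) (Q? ∘ suc) (R? ∘ suc) P⊆R Q⊆R P⊥Q)
... | no  _ | yes _ | yes _ = subst (_≤ suc (size (R? ∘ suc))) (sym (+-suc _ _))
                                (s≤s (size-disjoint (P? ∘ suc) (Q? ∘ suc) (R? ∘ suc) P⊆R Q⊆R P⊥Q))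
... | no  _ | no  _ | yes _ = m≤n⇒m≤1+n (size-disjoint (P? ∘ suc) (Q? ∘ suc) (R? ∘ suc) P⊆R Q⊆R P⊥Q)
... | no  _ | no  _ | no  _ = size-disjoint (P? ∘ suc) (Q? ∘ suc) (R? ∘ suc) P⊆R Q⊆R P⊥Q

size-∅ : ∀ {m} {P : Pred (Fin m) 0ℓ} (P? : Decidable P) → Empty P → size P? ≡ 0
size-∅ {zero}  P? _   = refl
size-∅ {suc m} P? ∅-P with P? zero
... | yes p = contradiction p (∅-P zero)
... | no  _ = size-∅ (P? ∘ suc) (∅-P ∘ suc)

least-index : ∀ {m} {P : Pred (Fin m) 0ℓ} → Decidable P → ∀ {i} → P i →
              ∃ λ j → P j × ∀ k → toℕ k < toℕ j → ¬ P k
least-index {suc m} P? {i} pi with P? zero | i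
... | yes p₀ | _     = zero , p₀ , λ _ ()
... | no ¬p₀ | zero  = contradiction pi ¬p₀
... | no ¬p₀ | suc i with least-index (P? ∘ suc) pi
...   | j , pj , least = suc j , pj , λ { zero _ → ¬p₀ ; (suc k) (s≤s k<j) → least k k<j }

binary-magnitude : ∀ n → 0 < n → ∃ λ m → 2 ^ m ≤ n × n < 2 ^ suc m
binary-magnitude (suc zero)    _ = 0 , ≤-refl , s≤s (s≤s z≤n)
binary-magnitude (suc (suc n)) _ with binary-magnitude (suc n) (s≤s z≤n)
... | m , lower , upper with suc (suc n) <? 2 ^ suc m
...   | yes upper′ = m , m≤n⇒m≤1+n lower , upper′
...   | no  ¬upper = suc m , ≤-reflexive (sym n+2≡2^m+1) , subst (_< 2 ^ suc (suc m)) (sym n+2≡2^m+1) doubling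
  where
  n+2≡2^m+1 : suc (suc n) ≡ 2 ^ suc m
  n+2≡2^m+1 = ≤-antisym upper (≮⇒≥ ¬upper)
  doubling : 2 ^ suc m < 2 ^ suc (suc m)
  doubling = ^-monoʳ-< 2 (s≤s (s≤s z≤n)) {suc m} ≤-refl

3^[3+j]≤2^[2+j]*2^[3+j] : ∀ j → 3 ^ (3 + j) ≤ 2 ^ (2 + j) * 2 ^ (3 + j)
3^[3+j]≤2^[2+j]*2^[3+j] zero    = from-yes (27 ≤? 32)
3^[3+j]≤2^[2+j]*2^[3+j] (suc j) = begin
  3 * 3 ^ (3 + j)                  ≤⟨ *-monoʳ-≤ 3 (3^[3+j]≤2^[2+j]*2^[3+j] j) ⟩
  3 * (a * b)                      ≤⟨ *-monoˡ-≤ (a * b) (from-yes (3 ≤? 4)) ⟩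
  4 * (a * b)                      ≡⟨ solve 2 (λ a b → con 4 :* (a :* b) := (con 2 :* a) :* (con 2 :* b)) refl a b ⟩
  (2 * a) * (2 * b)                ∎
  where
  open ≤-Reasoning
  a b : ℕ
  a = 2 ^ (2 + j)
  b = 2 ^ (3 + j)

3^[1+m]≤n*2^[1+m] : ∀ {n m} → 3 ≤ n → 2 ^ m ≤ n → n < 2 ^ suc m → 3 ^ suc m ≤ n * 2 ^ suc m
3^[1+m]≤n*2^[1+m] {m = zero}        3≤n _      n<2 = contradiction (≤-trans 3≤n (≤-pred n<2)) λ { (s≤s ()) }
3^[1+m]≤n*2^[1+m] {m = suc zero}    3≤n _      _   = ≤-trans (from-yes (9 ≤? 12)) (*-monoˡ-≤ 4 3≤n)
3^[1+m]≤n*2^[1+m] {m = suc (suc j)} _   2^m≤n  _   = ≤-trans (3^[3+j]≤2^[2+j]*2^[3+j] j) (*-monoˡ-≤ (2 ^ (3 + j)) 2^m≤n)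

module _ {a b n : ℕ} .{{_ : NonZero a}} (a≤b : a ≤ b) where

  power-ratio-step : ∀ {m} → b ^ suc m ≤ n * a ^ suc m → b ^ m ≤ n * a ^ m
  power-ratio-step {m} bound = *-cancelˡ-≤ a (begin
    a * b ^ m          ≤⟨ *-monoˡ-≤ (b ^ m) a≤b ⟩
    b * b ^ m          ≤⟨ bound ⟩
    n * (a * a ^ m)    ≡⟨ solve 3 (λ n a x → n :* (a :* x) := a :* (n :* x)) refl n a (a ^ m) ⟩
    a * (n * a ^ m)    ∎)
    where open ≤-Reasoning

  power-ratio-antitone : ∀ {k m} → k ≤ m → b ^ m ≤ n * a ^ m → b ^ k ≤ n * a ^ k
  power-ratio-antitone k≤m = go (≤⇒≤′ k≤m)
    where
    go : ∀ {k m} → k ≤′ m → b ^ m ≤ n * a ^ m → b ^ k ≤ n * a ^ k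
    go (≤′-reflexive refl) bound = bound
    go (≤′-step {m} k≤′m) bound = go k≤′m (power-ratio-step {m} bound)

module Walks {n : ℕ} (G : Graph n) where

  open import Data.List.Membership.DecPropositional (_≟_ {n}) using (_∈?_)

  private variable
    u v w x : Fin n
    p q : List (Fin n)

  Adj-sym : Adj G u v → Adj G v u
  Adj-sym {u} {v} uv = trans (symm G v u) uv

  Adj⇒≢ : Adj G u v → u ≢ v
  Adj⇒≢ {u} uu refl with trans (sym (irrefl G u)) uu
  ... | ()

  walk-head∈ : IsWalk G u v p → u ∈ p
  walk-head∈ (single u) = here refl
  walk-head∈ (step _ _) = here refl

  walk-last∈ : IsWalk G u v p → v ∈ p
  walk-last∈ (single u)  = here refl
  walk-last∈ (step _ wk) = there (walk-last∈ wk)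

  walk-++ : IsWalk G u w p → IsWalk G w v q → ∃ λ r → IsWalk G u v r × r ⊆ₗ p ++ q
  walk-++ (single u)      wq = _ , wq , there
  walk-++ (step uw wp) wq with walk-++ wp wq
  ... | r , wr , r⊆ = _ , step uw wr , λ { (here refl) → here refl ; (there x∈r) → there (r⊆ x∈r) }

  walk-reverse : IsWalk G u v p → ∃ λ r → IsWalk G v u r × r ⊆ₗ p
  walk-reverse (single u) = _ , single u , id
  walk-reverse (step {u} {w} uw wp) with walk-reverse wp
  ... | r , wr , r⊆ with walk-++ wr (step (Adj-sym uw) (single u))
  ...   | s , ws , s⊆ = s , ws , λ x∈s → [ (λ x∈r → there (r⊆ x∈r)) , ends ] (∈-++⁻ r (s⊆ x∈s))
    where
    ends : w ∷ u ∷ [] ⊆ₗ u ∷ _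
    ends (here refl)         = there (walk-head∈ wp)
    ends (there (here refl)) = here refl

  walk-length≥2 : IsWalk G u v p → u ≢ v → 2 ≤ length p
  walk-length≥2 (single u)          u≢u = contradiction refl u≢u
  walk-length≥2 (step _ (single _)) _   = s≤s (s≤s z≤n)
  walk-length≥2 (step _ (step _ _)) _   = s≤s (s≤s z≤n)

  path-suffix : IsPath G u v p → x ∈ p → ∃ λ s → IsPath G x v s × s ⊆ₗ p
  path-suffix path@(single _ , _)  (here refl) = _ , path , id
  path-suffix path@(step _ _ , _)  (here refl) = _ , path , id
  path-suffix (step _ wk , _ ∷ up) (there x∈p) with path-suffix (wk , up) x∈p
  ... | s , ps , s⊆ = s , ps , λ x∈s → there (s⊆ x∈s)
  path-suffix (single _ , _)       (there ())

  walk⇒path : IsWalk G u v p → ∃ λ q → IsPath G u v q × q ⊆ₗ p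
  walk⇒path (single u) = _ , (single u , [] ∷ []) , id
  walk⇒path (step {u} uw wk) with walk⇒path wk
  ... | q , (wq , uq) , q⊆ with u ∈? q
  ...   | yes u∈q = let s , ps , s⊆ = path-suffix (wq , uq) u∈q in s , ps , λ x∈s → there (q⊆ (s⊆ x∈s))
  ...   | no  u∉q = _ , (step uw wq , ¬Any⇒All¬ q u∉q ∷ uq)
                    , λ { (here refl) → here refl ; (there x∈q) → there (q⊆ x∈q) }

  path-drop : ∀ a {s} → IsPath G u v (a ++ s) → s ≢ [] → ∃ λ x → IsPath G x v s
  path-drop []            path                   _   = _ , path
  path-drop (_ ∷ [])      {[]} (single _ , _)    s≢[] = contradiction refl s≢[]
  path-drop (_ ∷ a)       (step _ wk , _ ∷ up)   s≢[] = path-drop a (wk , up) s≢[]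

  path-take : ∀ t {b} → IsPath G u v (t ++ b) → t ≢ [] → ∃ λ y → IsPath G u y t
  path-take []          _                      t≢[] = contradiction refl t≢[]
  path-take (_ ∷ [])    (single u , _)         _    = u , single u , [] ∷ []
  path-take (_ ∷ [])    (step {u} _ _ , _)     _    = u , single u , [] ∷ []
  path-take (_ ∷ z ∷ t) (step uw wk , u∉ ∷ up) _    with path-take (z ∷ t) (wk , up) (λ ())
  ... | y , wy , uy = y , step uw wy , proj₁ (++⁻ (z ∷ t) u∉) ∷ uy

  path-infix : ∀ a t b → IsPath G u v (a ++ t ++ b) → t ≢ [] → ∃₂ λ x y → IsPath G x y t
  path-infix a t b path t≢[] with path-drop a path (λ t++b≡[] → t≢[] (++-conicalˡ t b t++b≡[]))
  ... | x , path′ = x , path-take t path′ t≢[]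

module TreePaths {n : ℕ} {T : Graph n} (tree : IsTree T) where

  open Walks T

  private variable
    a b w x : Fin n
    p q : List (Fin n)

  path-unique : IsPath T a b p → IsPath T a b q → p ≡ q
  path-unique (single a , _) (single a , _) = refl
  path-unique (single a , _) (step _ wk , a∉ ∷ _) = contradiction (walk-last∈ wk) (All¬⇒¬Any a∉)
  path-unique (step _ wk , a∉ ∷ _) (single a , _) = contradiction (walk-last∈ wk) (All¬⇒¬Any a∉)
  path-unique (step {a} {w} aw wk , a∉ ∷ up) (step {w = w′} aw′ wk′ , a∉′ ∷ up′) with w ≟ w′
  ... | yes refl = cong (a ∷_) (path-unique (wk , up) (wk′ , up′))
  -- The second vertices differ: w′ ⋯ b ⋯ w avoids a, closing a cycle through a.
  ... | no w≢w′ with walk-reverse wk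
  ...   | r , wr , r⊆ with walk-++ wk′ wr
  ...     | s , ws , s⊆ with walk⇒path ws
  ...       | q , (wq , uq) , q⊆ =
    contradiction (a , w , a ∷ q , (step aw′ wq , ¬Any⇒All¬ q a∉q ∷ uq) , s≤s (walk-length≥2 wq (w≢w′ ∘ sym)) , Adj-sym aw)
                  (proj₂ tree)
    where
    a∉q : a ∉ q
    a∉q a∈q = [ All¬⇒¬Any a∉′ , All¬⇒¬Any a∉ ∘ r⊆ ] (∈-++⁻ _ (s⊆ (q⊆ a∈q)))

  path : Fin n → Fin n → List (Fin n)
  path x y = proj₁ (proj₁ tree x y)

  path-isPath : ∀ x y → IsPath T x y (path x y)
  path-isPath x y = proj₂ (proj₁ tree x y)

  path-canonical : IsPath T a b p → p ≡ path a b
  path-canonical pp = path-unique pp (path-isPath _ _)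

  path-source∈ : ∀ a b → a ∈ path a b
  path-source∈ a b = walk-head∈ (proj₁ (path-isPath a b))

  path-target∈ : ∀ a b → b ∈ path a b
  path-target∈ a b = walk-last∈ (proj₁ (path-isPath a b))

  path-⊆-walk : IsWalk T a b p → path a b ⊆ₗ p
  path-⊆-walk wk with walk⇒path wk
  ... | q , pq , q⊆ = subst (_⊆ₗ _) (path-canonical pq) q⊆

  path-sym-⊆ : ∀ a b → path b a ⊆ₗ path a b
  path-sym-⊆ a b with walk-reverse (proj₁ (path-isPath a b))
  ... | r , wr , r⊆ = r⊆ ∘ path-⊆-walk wr

  path-trans-⊆ : ∀ a b c → path a c ⊆ₗ path a b ++ path b c
  path-trans-⊆ a b c with walk-++ (proj₁ (path-isPath a b)) (proj₁ (path-isPath b c))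
  ... | r , wr , r⊆ = r⊆ ∘ path-⊆-walk wr

  path-suffix-⊆ : x ∈ path a b → path x b ⊆ₗ path a b
  path-suffix-⊆ x∈ with path-suffix (path-isPath _ _) x∈
  ... | s , ps , s⊆ = subst (_⊆ₗ _) (path-canonical ps) s⊆

  path-prefix-⊆ : x ∈ path a b → path a x ⊆ₗ path a b
  path-prefix-⊆ {x} {a} {b} x∈ = path-sym-⊆ a b ∘ path-suffix-⊆ (path-sym-⊆ b a x∈) ∘ path-sym-⊆ x a

  path-self : ∀ a → path a a ≡ a ∷ []
  path-self a = sym (path-canonical (single a , [] ∷ []))

  path-cons : Adj T a w → a ∉ path w b → path a b ≡ a ∷ path w b
  path-cons {w = w} {b} aw a∉ with path-isPath w b
  ... | wk , up = sym (path-canonical (step aw wk , ¬Any⇒All¬ _ a∉ ∷ up))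

  path-step : b ≢ a → ∃ λ w → Adj T a w × path a b ≡ a ∷ path w b × a ∉ path w b
  path-step {b} {a} b≢a = from (path-isPath a b) refl
    where
    from : IsPath T a b p → p ≡ path a b → ∃ λ w → Adj T a w × path a b ≡ a ∷ path w b × a ∉ path w b
    from (single _ , _)         _  = contradiction refl b≢a
    from (step aw wk , a∉ ∷ up) eq =
      _ , aw , trans (sym eq) (cong (a ∷_) (path-canonical (wk , up))) ,
      subst (a ∉_) (path-canonical (wk , up)) (All¬⇒¬Any a∉)

  path-suffix-∌ : x ∈ path a b → x ≢ a → a ∉ path x b
  path-suffix-∌ {x} {a} {b} x∈ x≢a with b ≟ a
  ... | yes refl with subst (x ∈_) (path-self a) x∈
  ...   | here x≡a = contradiction x≡a x≢a
  path-suffix-∌ {x} {a} {b} x∈ x≢a | no b≢a with path-step b≢a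
  ...   | w , _ , eq , a∉ with subst (x ∈_) eq x∈
  ...     | here x≡a = contradiction x≡a x≢a
  ...     | there x∈ = a∉ ∘ path-suffix-⊆ x∈

module ColourCounts {n K : ℕ} (G : Graph n) (c : Fin n → Fin K) where

  countColour≡0⇒∌ : ∀ {γ} s → countColour G c γ s ≡ 0 → All (λ z → c z ≢ γ) s
  countColour≡0⇒∌ []      _ = []
  countColour≡0⇒∌ {γ} (x ∷ s) none with c x ≟ γ
  countColour≡0⇒∌ (x ∷ s) ()   | yes _
  countColour≡0⇒∌ (x ∷ s) none | no cx≢γ = cx≢γ ∷ countColour≡0⇒∌ s none

  countColour≡1⇒split : ∀ {γ} s → countColour G c γ s ≡ 1 →
                        ∃ λ l → ∃ λ y → ∃ λ r → s ≡ l ++ y ∷ r × c y ≡ γ ×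
                        All (λ z → c z ≢ γ) l × All (λ z → c z ≢ γ) r
  countColour≡1⇒split {γ} (x ∷ s) once with c x ≟ γ
  ... | yes cx≡γ = [] , x , s , refl , cx≡γ , [] , countColour≡0⇒∌ s (suc-injective once)
  ... | no  cx≢γ with countColour≡1⇒split s once
  ...   | l , y , r , refl , cy≡γ , l∌γ , r∌γ = x ∷ l , y , r , refl , cy≡γ , cx≢γ ∷ l∌γ , r∌γ

  ∌⇒countColour≡0 : ∀ {γ} s → (∀ {y} → y ∈ s → c y ≢ γ) → countColour G c γ s ≡ 0
  ∌⇒countColour≡0 []      _ = refl
  ∌⇒countColour≡0 {γ} (x ∷ s) s∌γ rewrite filter-reject (λ z → c z ≟ γ) {x} {s} (s∌γ (here refl)) =
    ∌⇒countColour≡0 s (s∌γ ∘ there)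

  uniqueColour⇒countColour≡1 : ∀ {x} s → Unique s → x ∈ s → (∀ {y} → y ∈ s → y ≢ x → c y ≢ c x) →
                                 countColour G c (c x) s ≡ 1
  uniqueColour⇒countColour≡1 (x ∷ s) (x∉s ∷ _) (here refl) others
    rewrite filter-accept (λ z → c z ≟ c x) {x} {s} refl =
    cong suc (∌⇒countColour≡0 s (λ y∈s → others (there y∈s) (λ { refl → All.lookup x∉s y∈s refl })))
  uniqueColour⇒countColour≡1 {x} (z ∷ s) (z∉s ∷ us) (there x∈s) others
    rewrite filter-reject (λ y → c y ≟ c x) {z} {s} (others (here refl) (λ { refl → All.lookup z∉s x∈s refl })) =
    uniqueColour⇒countColour≡1 s us x∈s (others ∘ there)

  equalColours⇒countColour≢1 : ∀ {i j} γ → c i ≡ c j → countColour G c γ (i ∷ j ∷ []) ≢ 1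
  equalColours⇒countColour≢1 {i} {j} γ ci≡cj = twins (c i ≟ γ)
    where
    twins : Dec (c i ≡ γ) → countColour G c γ (i ∷ j ∷ []) ≢ 1
    twins (yes ci≡γ) rewrite filter-accept (λ x → c x ≟ γ) {i} {j ∷ []} ci≡γ
                           | filter-accept (λ x → c x ≟ γ) {j} {[]} (trans (sym ci≡cj) ci≡γ) = λ ()
    twins (no  ci≢γ) rewrite filter-reject (λ x → c x ≟ γ) {i} {j ∷ []} ci≢γ
                           | filter-reject (λ x → c x ≟ γ) {j} {[]} (ci≢γ ∘ trans ci≡cj) = λ ()

module Segments {n K : ℕ} (G : Graph n) (c : Fin n → Fin K) where

  open ColourCounts G c

  AllSegmentsCF : List (Fin n) → Set
  AllSegmentsCF s = ∀ a t b → s ≡ a ++ t ++ b → t ≢ [] → ConflictFree G c t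

  segmentsCF-++ˡ : ∀ l y r → AllSegmentsCF (l ++ y ∷ r) → AllSegmentsCF l
  segmentsCF-++ˡ l y r cf a t b refl = cf a t (b ++ y ∷ r) (begin
    ((a ++ t ++ b) ++ y ∷ r) ≡⟨ ++-assoc a (t ++ b) (y ∷ r) ⟩
    a ++ (t ++ b) ++ y ∷ r   ≡⟨ cong (a ++_) (++-assoc t b (y ∷ r)) ⟩
    a ++ t ++ b ++ y ∷ r     ∎)
    where open ≡-Reasoning

  segmentsCF-++ʳ : ∀ l y r → AllSegmentsCF (l ++ y ∷ r) → AllSegmentsCF r
  segmentsCF-++ʳ l y r cf a t b refl = cf (l ++ y ∷ a) t b (sym (++-assoc l (y ∷ a) (t ++ b)))

  -- The colour occurring once splits s into two segments that avoid it.
  length<2^palette : ∀ k {Pal : Pred (Fin K) 0ℓ} (Pal? : Decidable Pal) → size Pal? ≤ k →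
                     ∀ s → All (Pal ∘ c) s → AllSegmentsCF s → length s < 2 ^ k
  length<2^palette k Pal? _ [] _ _ = m^n>0 2 k
  length<2^palette k {Pal} Pal? bound s@(_ ∷ _) inPal cf with cf [] s [] (sym (++-identityʳ s)) (λ ())
  ... | γ , once with countColour≡1⇒split s once
  ... | l , y , r , s≡ , cy≡γ , l∌γ , r∌γ =
    subst (λ s → length s < 2 ^ k) (sym s≡) (split-bound k bound)
    where
    open ≤-Reasoning

    inPal-l : All (Pal ∘ c) l
    inPal-l = proj₁ (++⁻ l (subst (All (Pal ∘ c)) s≡ inPal))

    inPal-yr : All (Pal ∘ c) (y ∷ r)
    inPal-yr = proj₂ (++⁻ l (subst (All (Pal ∘ c)) s≡ inPal))

    γ∈Pal : Pal γ
    γ∈Pal = subst Pal cy≡γ (All.head inPal-yr)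

    Pal-γ? : Decidable (λ i → Pal i × i ≢ γ)
    Pal-γ? i = Pal? i ×-dec ¬? (i ≟ γ)

    fewer-colours : size Pal-γ? < size Pal?
    fewer-colours = size-mono-< Pal-γ? Pal? proj₁ γ∈Pal (λ (_ , γ≢γ) → γ≢γ refl)

    split-bound : ∀ k → size Pal? ≤ k → length (l ++ y ∷ r) < 2 ^ k
    split-bound zero    bound = contradiction bound (<⇒≱ (size-pos Pal? γ∈Pal))
    split-bound (suc k) bound = begin-strict
      length (l ++ y ∷ r)          ≡⟨ length-++ l ⟩
      length l + suc (length r)    <⟨ +-mono-<-≤ (half l (All.zip (inPal-l , l∌γ)) (segmentsCF-++ˡ l y r cf′))
                                                 (half r (All.zip (All.tail inPal-yr , r∌γ)) (segmentsCF-++ʳ l y r cf′)) ⟩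
      2 ^ k + 2 ^ k                ≡⟨ cong (2 ^ k +_) (sym (+-identityʳ (2 ^ k))) ⟩
      2 ^ suc k                    ∎
      where
      cf′ : AllSegmentsCF (l ++ y ∷ r)
      cf′ = subst AllSegmentsCF s≡ cf

      half : ∀ s → All (λ z → Pal (c z) × c z ≢ γ) s → AllSegmentsCF s → length s < 2 ^ k
      half = length<2^palette k Pal-γ? (≤-pred (≤-trans fewer-colours bound))

module LowerBound {n K : ℕ} {T : Graph n} (tree : IsTree T) {c : Fin n → Fin K}
                  (cf : CFVertexConnected T c) where

  open Walks T
  open TreePaths tree
  open ColourCounts T c
  open Segments T c

  cf⇒proper : ProperColoring T c
  cf⇒proper i j ij ci≡cj with cf i j
  ... | p , pp , γ , once =
    equalColours⇒countColour≢1 γ ci≡cj (subst (λ q → countColour T c γ q ≡ 1) (path-unique pp edge) once)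
    where
    edge : IsPath T i j (i ∷ j ∷ [])
    edge = step ij (single j) , (Adj⇒≢ ij ∷ []) ∷ [] ∷ []

  cf⇒diameter< : ∀ {d} → IsDiameter T d → suc d ≤ 2 ^ K
  cf⇒diameter< ((u , v , (p , pp , length≡) , _) , _) =
    ≤-trans (n≤1+n _) (subst (_< 2 ^ K) length≡
      (length<2^palette K (λ _ → yes tt) (size≤ _) p (All.tabulate (λ _ → tt)) segmentsCF))
    where
    segmentsCF : AllSegmentsCF p
    segmentsCF a t b p≡ t≢[] with path-infix a t b (subst (IsPath T u v) p≡ pp) t≢[]
    ... | x , y , pt with cf x y
    ...   | q , pq , cfq = subst (ConflictFree T c) (path-unique pq pt) cfq

module Components {n : ℕ} {T : Graph n} (tree : IsTree T) where

  open Walks T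
  open TreePaths tree

  private variable
    X Y : Pred (Fin n) 0ℓ
    t u v w x y z z₁ z₂ : Fin n

  -- Vertex sets are decidable predicates; Linked X x is the component of x in the
  -- forest induced by X.
  Linked : Pred (Fin n) 0ℓ → Fin n → Fin n → Set
  Linked X x y = All X (path x y)

  linked? : Decidable X → ∀ x y → Dec (Linked X x y)
  linked? X? x y = All.all? X? (path x y)

  componentSize : Decidable X → Fin n → ℕ
  componentSize X? x = size (linked? X? x)

  _─_ : Pred (Fin n) 0ℓ → Fin n → Pred (Fin n) 0ℓ
  (X ─ v) t = X t × t ≢ v

  _─?_ : Decidable X → ∀ v → Decidable (X ─ v)
  (X? ─? v) t = X? t ×-dec ¬? (t ≟ v)

  linked-refl : X x → Linked X x x
  linked-refl {x = x} Xx = subst (All _) (sym (path-self x)) (Xx ∷ [])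

  linked-sym : Linked X x y → Linked X y x
  linked-sym {x = x} {y} = All-resp-⊇ (path-sym-⊆ x y)

  linked-trans : Linked X x y → Linked X y z → Linked X x z
  linked-trans {x = x} {y} {z} xy yz =
    All.tabulate (λ t∈ → [ All.lookup xy , All.lookup yz ] (∈-++⁻ _ (path-trans-⊆ x y z t∈)))

  linked-prefix : t ∈ path x y → Linked X x y → Linked X x t
  linked-prefix t∈ = All-resp-⊇ (path-prefix-⊆ t∈)

  linked-suffix : t ∈ path x y → Linked X x y → Linked X t y
  linked-suffix t∈ = All-resp-⊇ (path-suffix-⊆ t∈)

  linked-source : Linked X x y → X x
  linked-source {x = x} {y} xy = All.lookup xy (path-source∈ x y)

  linked-target : Linked X x y → X y
  linked-target {x = x} {y} xy = All.lookup xy (path-target∈ x y)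

  linked-mono : X ⊆ Y → Linked X x y → Linked Y x y
  linked-mono X⊆Y = All.map X⊆Y

  linked-─ : Linked X x y → v ∉ path x y → Linked (X ─ v) x y
  linked-─ xy v∉ = All.tabulate (λ t∈ → All.lookup xy t∈ , λ { refl → v∉ t∈ })

  linked-─⁻ : Linked (X ─ v) x y → v ∉ path x y
  linked-─⁻ xy v∈ = proj₂ (All.lookup xy v∈) refl

  path-through-neighbour : Adj T v w → v ∉ path w t → w ∈ path v t
  path-through-neighbour {w = w} {t} vw v∉ = subst (w ∈_) (sym (path-cons vw v∉)) (there (path-source∈ w t))

  module Centroid {X : Pred (Fin n) 0ℓ} (X? : Decidable X) (m : ℕ) where

    Balanced : Pred (Fin n) 0ℓ
    Balanced v = X v × ∀ y → Linked X v y → componentSize (X? ─? v) y < 2 ^ m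

    balanced? : Decidable Balanced
    balanced? v = X? v ×-dec Fin.all? (λ y → linked? X? v y →-dec (componentSize (X? ─? v) y <? 2 ^ m))

    Heavy : Fin n → Fin n → Set
    Heavy v y = Linked X v y × 2 ^ m ≤ componentSize (X? ─? v) y

    unbalanced⇒heavy : X v → ¬ Balanced v → ∃ (Heavy v)
    unbalanced⇒heavy {v} Xv ¬bal
      with Fin.¬∀⟶∃¬ n _ (λ y → linked? X? v y →-dec (componentSize (X? ─? v) y <? 2 ^ m)) (¬bal ∘ (Xv ,_))
    ... | y , ¬small with linked? X? v y
    ...   | yes vy    = y , vy , ≮⇒≥ (λ small → ¬small (λ _ → small))
    ...   | no  ¬vy   = contradiction (λ vy → contradiction vy ¬vy) ¬small

    heavy⇒≢ : Heavy v y → y ≢ v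
    heavy⇒≢ {v} (_ , heavy) refl = <⇒≱ (m^n>0 2 m) (subst (2 ^ m ≤_) v-isolated heavy)
      where
      v-isolated : componentSize (X? ─? v) v ≡ 0
      v-isolated = size-∅ (linked? (X? ─? v) v) (λ t vt → proj₂ (linked-source vt) refl)

    toward-heavy : Heavy v y → ∃ λ w → Adj T v w × Linked X v w × Linked (X ─ v) y w
    toward-heavy {v} {y} hv@(vy , _) with path-step (heavy⇒≢ hv)
    ... | w , vw , path≡ , v∉ = w , vw , linked-prefix w∈ vy , linked-sym (linked-─ (linked-suffix w∈ vy) v∉)
      where
      w∈ : w ∈ path v y
      w∈ = subst (w ∈_) (sym path≡) (there (path-source∈ w y))

    branch⊆component : Linked X x y → Linked (X ─ v) y ⊆ Linked X x
    branch⊆component xy yt = linked-trans xy (linked-mono proj₁ yt)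

    branches-apart : Adj T v w → Linked (X ─ v) y w → Linked (X ─ w) z v →
                     Linked (X ─ v) y Disjoint Linked (X ─ w) z
    branches-apart vw yw zv (yt , zt) =
      linked-─⁻ (linked-trans (linked-sym zv) zt)
                (path-through-neighbour vw (linked-─⁻ (linked-trans (linked-sym yw) yt)))

    branch-shrinks : Adj T v w → Linked (X ─ v) y w → Linked X w z → ¬ Linked (X ─ w) z v →
                     Linked (X ─ w) z ⊆ Linked (X ─ v) y
    branch-shrinks {v} {w} {z = z} vw yw wz ¬zv {t} zt = linked-trans yw (linked-trans wz′ zt′)
      where
      wz′ : Linked (X ─ v) w z
      wz′ = linked-─ wz (λ v∈ → ¬zv (linked-sym (linked-─ (linked-suffix v∈ wz) (path-suffix-∌ v∈ (Adj⇒≢ vw)))))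

      zt′ : Linked (X ─ v) z t
      zt′ = linked-─ (linked-mono proj₁ zt) (λ v∈ → ¬zv (linked-prefix v∈ zt))

    module _ {x : Fin n} (small : componentSize X? x < 2 ^ suc m) where

      -- The heavy branch at the next vertex w
      -- cannot contain v (the two branches would be disjoint and together exceed the
      -- component), so it lies strictly inside the heavy branch at v.
      descend : Linked X x v → Heavy v y →
                ∃ λ w → Linked X x w ×
                (Balanced w ⊎ ∃ λ z → Heavy w z × componentSize (X? ─? w) z < componentSize (X? ─? v) y)
      descend {v} {y} xv hv@(vy , heavy) with toward-heavy hv
      ... | w , vw , vw-linked , yw = w , xw , next (balanced? w)
        where
        xw : Linked X x w
        xw = linked-trans xv vw-linked

        next : Dec (Balanced w) →
               Balanced w ⊎ ∃ λ z → Heavy w z × componentSize (X? ─? w) z < componentSize (X? ─? v) y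
        next (yes bal) = inj₁ bal
        next (no ¬bal) with unbalanced⇒heavy (linked-target vw-linked) ¬bal
        ... | z , hz@(wz , heavy′) with linked? (X? ─? w) z v
        ...   | no ¬zv = inj₂ (z , hz , size-mono-< (linked? (X? ─? w) z) (linked? (X? ─? v) y)
                                          (branch-shrinks vw yw wz ¬zv) yw (λ zw → proj₂ (linked-target zw) refl))
        ...   | yes zv = contradiction (begin
            2 ^ suc m                                                  ≡⟨ cong (2 ^ m +_) (+-identityʳ (2 ^ m)) ⟩
            2 ^ m + 2 ^ m                                              ≤⟨ +-mono-≤ heavy heavy′ ⟩
            componentSize (X? ─? v) y + componentSize (X? ─? w) z      ≤⟨ size-disjoint _ _ (linked? X? x)
                 (branch⊆component (linked-trans xv vy)) (branch⊆component (linked-trans xw wz)) (branches-apart vw yw zv) ⟩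
            componentSize X? x                                         ∎) (<⇒≱ small)
          where open ≤-Reasoning

      centroid-from : Linked X x v → Heavy v y → Acc _<_ (componentSize (X? ─? v) y) →
                      ∃ λ g → Balanced g × Linked X x g
      centroid-from xv hv (acc rec) with descend xv hv
      ... | w , xw , inj₁ bal              = w , bal , xw
      ... | w , xw , inj₂ (z , hz , lighter) = centroid-from xw hz (rec lighter)

      centroid : X x → ∃ λ g → Balanced g × Linked X x g
      centroid Xx with balanced? x
      ... | yes bal = x , bal , linked-refl Xx
      ... | no ¬bal with unbalanced⇒heavy Xx ¬bal
      ...   | y , hy = centroid-from (linked-refl Xx) hy (<-wellFounded _)

  module Centres {X : Pred (Fin n) 0ℓ} (X? : Decidable X) (m : ℕ)
                 (small : ∀ {x} → X x → componentSize X? x < 2 ^ suc m) where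

    open Centroid X? m

    -- Taking the balanced vertex of least index makes the centre of a component unique.
    Centre : Pred (Fin n) 0ℓ
    Centre v = Balanced v × ∀ w → toℕ w < toℕ v → Linked X v w → ¬ Balanced w

    centre? : Decidable Centre
    centre? v = balanced? v ×-dec Fin.all? (λ w → (toℕ w <? toℕ v) →-dec (linked? X? v w →-dec ¬? (balanced? w)))

    centre-exists : X x → ∃ λ z → Centre z × Linked X x z
    centre-exists {x} Xx with centroid (small Xx) Xx
    ... | g , bg , xg with least-index (λ z → balanced? z ×-dec linked? X? x z) (bg , xg)
    ...   | z , (bz , xz) , least = z , (bz , λ w w<z zw bw → least w w<z (bw , linked-trans xz zw)) , xz

    linked-centres-coincide : Linked X z₁ z₂ → Centre z₁ → Centre z₂ → z₁ ≡ z₂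
    linked-centres-coincide {z₁} {z₂} z₁z₂ (b₁ , least₁) (b₂ , least₂) with Fin.<-cmp z₁ z₂
    ... | tri< z₁<z₂ _ _ = contradiction b₁ (least₂ z₁ z₁<z₂ (linked-sym z₁z₂))
    ... | tri≈ _ z₁≡z₂ _ = z₁≡z₂
    ... | tri> _ _ z₂<z₁ = contradiction b₂ (least₁ z₂ z₂<z₁ z₁z₂)

    centres-on-path-coincide : Linked X u v → z₁ ∈ path u v → z₂ ∈ path u v → Centre z₁ → Centre z₂ → z₁ ≡ z₂
    centres-on-path-coincide uv z₁∈ z₂∈ =
      linked-centres-coincide (linked-trans (linked-sym (linked-prefix z₁∈ uv)) (linked-prefix z₂∈ uv))

    Rest : Pred (Fin n) 0ℓ
    Rest t = X t × ¬ Centre t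

    rest? : Decidable Rest
    rest? t = X? t ×-dec ¬? (centre? t)

    rest-small : Rest y → componentSize rest? y < 2 ^ m
    rest-small {y} (Xy , _) with centre-exists Xy
    ... | z , cz@((_ , balanced) , _) , yz =
      ≤-<-trans (size-mono (linked? rest? y) (linked? (X? ─? z) y) rest⊆) (balanced y (linked-sym yz))
      where
      rest⊆ : Linked Rest y ⊆ Linked (X ─ z) y
      rest⊆ = linked-mono (λ (Xt , ¬ct) → Xt , λ { refl → ¬ct cz })

  UniqueMax : (Fin n → ℕ) → List (Fin n) → Set
  UniqueMax c p = ∃ λ x → x ∈ p × ∀ {y} → y ∈ p → y ≢ x → c y < c x

  ranking : ∀ m {X} (X? : Decidable X) → (∀ {x} → X x → componentSize X? x < 2 ^ m) →
            ∃ λ (c : Fin n → ℕ) → (∀ {x} → X x → c x < m) × (∀ {u v} → Linked X u v → UniqueMax c (path u v))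
  ranking zero {X} X? small = (λ _ → 0) , ⊥-elim ∘ X-empty , ⊥-elim ∘ X-empty ∘ linked-source
    where
    X-empty : X x → ⊥
    X-empty Xx = <⇒≱ (size-pos (linked? X? _) (linked-refl Xx)) (≤-pred (small Xx))
  ranking (suc m) {X} X? small with ranking m (Centres.rest? X? m small) (Centres.rest-small X? m small)
  ... | c′ , c′< , c′-max = colour , colour< , colour-max
    where
    open Centres X? m small

    colour : Fin n → ℕ
    colour t with centre? t
    ... | yes _ = m
    ... | no  _ = c′ t

    colour-centre : Centre t → colour t ≡ m
    colour-centre {t} ct with centre? t
    ... | yes _   = refl
    ... | no ¬ct  = contradiction ct ¬ct

    colour-rest : ¬ Centre t → colour t ≡ c′ t
    colour-rest {t} ¬ct with centre? t
    ... | yes ct = contradiction ct ¬ct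
    ... | no  _  = refl

    colour< : X x → colour x < suc m
    colour< {x} Xx with centre? x
    ... | yes _   = ≤-refl
    ... | no  ¬cx = m≤n⇒m≤1+n (c′< (Xx , ¬cx))

    colour-max : Linked X u v → UniqueMax colour (path u v)
    colour-max {u} {v} uv with any? centre? (path u v)
    ... | yes some with find some
    ...   | z , z∈ , cz = z , z∈ , below-centre
      where
      below-centre : y ∈ path u v → y ≢ z → colour y < colour z
      below-centre {y} y∈ y≢z = subst₂ _<_ (sym (colour-rest ¬cy)) (sym (colour-centre cz)) (c′< (All.lookup uv y∈ , ¬cy))
        where
        ¬cy : ¬ Centre y
        ¬cy cy = y≢z (centres-on-path-coincide uv y∈ z∈ cy cz)
    colour-max {u} {v} uv | no none with c′-max (All.zip (uv , ¬Any⇒All¬ _ none))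
    ...   | x , x∈ , max =
      x , x∈ , λ y∈ y≢x → subst₂ _<_ (sym (colour-rest (¬centre y∈))) (sym (colour-rest (¬centre x∈))) (max y∈ y≢x)
      where
      ¬centre : t ∈ path u v → ¬ Centre t
      ¬centre t∈ = All.lookup (¬Any⇒All¬ _ none) t∈

module UpperBound {n : ℕ} {T : Graph n} (tree : IsTree T) where
  open TreePaths tree
  open Components tree

  cf-colourable : ∀ m → n < 2 ^ m → CFColorable T m
  cf-colourable m n<2^m with ranking m (λ _ → yes tt) (λ _ → ≤-<-trans (size≤ _) n<2^m)
  ... | rank , rank< , unique-max = colour , conflict-free
    where
    colour : Fin n → Fin m
    colour x = fromℕ< (rank< tt)

    conflict-free : CFVertexConnected T colour
    conflict-free u v with unique-max (All.tabulate (λ _ → tt))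
    ... | x , x∈ , others-lower =
      path u v , path-isPath u v , colour x ,
      ColourCounts.uniqueColour⇒countColour≡1 T colour (path u v) (proj₂ (path-isPath u v)) x∈
        (λ y∈ y≢x colour≡ → <⇒≢ (others-lower y∈ y≢x) (Fin.fromℕ<-injective _ _ (rank< tt) (rank< tt) colour≡))

theorem6 : (n : ℕ) (T : Graph n) → IsTree T → 3 ≤ n →
    (χ d k : ℕ) → IsChromaticNumber T χ → IsDiameter T d → IsVcfc T k →
    (χ ≤ k × suc d ≤ 2 ^ k) × 3 ^ k ≤ n * 2 ^ k
theorem6 n T tree 3≤n χ d k (_ , χ-least) diameter ((c , cf) , k-least)
  with binary-magnitude n (≤-trans (s≤s z≤n) 3≤n)
... | m , 2^m≤n , n<2^m+1 =
  (χ-least k (c , cf⇒proper) , cf⇒diameter< diameter) ,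
  power-ratio-antitone {2} {3} {n} (s≤s (s≤s z≤n)) (k-least (suc m) (cf-colourable (suc m) n<2^m+1))
                       (3^[1+m]≤n*2^[1+m] {n} {m} 3≤n 2^m≤n n<2^m+1)
  where
  open LowerBound tree cf
  open UpperBound tree
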